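{- There is a positive integer $D$ such that every connected finite simple graph $G$ with Edge-compelling chromatic number $4$ and diameter at least $D$ contains a subgraph $H$ that is complete bipartite such that the graph $G-V(H)$ obtained by deleting the vertices of $H$ is bipartite.
   Context: A proper coloring partitions $V(G)$ into nonempty independent color classes; a rainbow committee (RC) is a set consisting of exactly one vertex of each color. A proper coloring is Edge-compelling if every RC contains at least one pair of adjacent vertices; the Edge-compelling chromatic number is the minimum number of colors in an Edge-compelling proper coloring. -}

module Defs where

open import Data.Nat using (ℕ; zero; suc; _<_)
open import Data.Fin using (Fin)
open import Data.Fin.Subset using (Subset; _∈_; _∉_)
open import Data.Product using (Σ; ∃; ∃-syntax; _×_; _,_)
open import Relation.Nullary using (¬_; Dec)
open import Relation.Binary.PropositionalEquality using (_≡_; _≢_)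

record Graph (n : ℕ) : Set₁ where
  field
    Adj    : Fin n → Fin n → Set
    sym    : ∀ {u v} → Adj u v → Adj v u
    irrefl : ∀ {u} → ¬ Adj u u
    dec    : ∀ u v → Dec (Adj u v)
open Graph public

module _ {n : ℕ} (G : Graph n) where

  data Walk : Fin n → Fin n → ℕ → Set where
    here : ∀ {u} → Walk u u zero
    step : ∀ {u w v ℓ} → Adj G u w → Walk w v ℓ → Walk u v (suc ℓ)

  Connected : Set
  Connected = ∀ u v → ∃[ ℓ ] Walk u v ℓ

  DistAtLeast : Fin n → Fin n → ℕ → Set
  DistAtLeast u v D = ∀ ℓ → ℓ < D → ¬ Walk u v ℓ

  DiameterAtLeast : ℕ → Set
  DiameterAtLeast D = ∃[ u ] ∃[ v ] DistAtLeast u v D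

  record ProperColoring (k : ℕ) : Set where
    field
      col      : Fin n → Fin k
      proper   : ∀ {u v} → Adj G u v → col u ≢ col v
      nonempty : ∀ (i : Fin k) → ∃[ v ] col v ≡ i
  open ProperColoring public

  RainbowCommittee : ∀ {k} → ProperColoring k → Set
  RainbowCommittee {k} c = Σ (Fin k → Fin n) λ r → ∀ i → col c (r i) ≡ i

  EdgeCompelling : ∀ {k} → ProperColoring k → Set
  EdgeCompelling {k} c =
    ∀ (rc : RainbowCommittee c) →
      let r = Data.Product.proj₁ rc in ∃[ i ] ∃[ j ] Adj G (r i) (r j)

  ECChromaticNumberIs : ℕ → Set
  ECChromaticNumberIs k =
    (Σ (ProperColoring k) EdgeCompelling)
    × (∀ m → m < k → (c : ProperColoring m) → ¬ EdgeCompelling c)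

  CompleteBipartiteSubgraph : Subset n → Subset n → Set
  CompleteBipartiteSubgraph A B =
    (∃[ a ] a ∈ A) × (∃[ b ] b ∈ B)
    × (∀ v → v ∈ A → v ∉ B)
    × (∀ a b → a ∈ A → b ∈ B → Adj G a b)

  BipartiteAfterDeleting : Subset n → Subset n → Set
  BipartiteAfterDeleting A B =
    Σ (Fin n → Fin 2) λ f → ∀ u v → u ∉ A → u ∉ B → v ∉ A → v ∉ B →
      Adj G u v → f u ≢ f v

module Submission where

-- Fix an Edge-compelling proper 4-colouring. If two colour classes are completely joined, they
-- are the parts of H, and the two remaining colour classes 2-colour G − V(H). Otherwise every
-- pair of colours i, j has a non-adjacent witness pair coloured i and j. Layer G by distance from
-- one end u of a pair at distance ≥ D. Each of the 32 witness vertices lies within distance 1 of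
-- at most one of 33 windows of four consecutive layers spaced six apart, so some window is at
-- layer distance ≥ 2 from all of them. A vertex of its bottom layer and an edge between its top
-- two layers yield a non-adjacent pair a, b of distinct colours k, l inside the window; with the
-- witness pair of the two remaining colours it forms an independent rainbow committee,
-- contradicting Edge-compellingness.

open import Defs hiding (sym)
open import Data.Nat using (ℕ; zero; suc; _+_; _*_; _<_; _≤_; _≤′_; ≤′-refl; ≤′-step; z≤n; s≤s; _≤?_)
open import Data.Nat.Properties
  using (≤⇒≤′; ≤-pred; ≤-refl; ≤-trans; n≤1+n; m≤n⇒m≤1+n; m≤n+m; ≰⇒>; <-irrefl; *-monoˡ-≤; +-monoˡ-≤; +-suc; module ≤-Reasoning)
open import Data.Fin using (Fin; zero; suc; toℕ; combine; remQuot; _≟_) renaming (_<_ to _<ᶠ_)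
import Data.Fin.Properties as Fin
open import Data.Fin.Subset using (Subset; _∉_) renaming (_∈_ to _∈ₛ_)
open import Data.Product using (Σ; ∃-syntax; _×_; _,_; proj₁; proj₂; uncurry)
open import Data.Sum using (_⊎_; inj₁; inj₂; [_,_]′)
open import Data.Empty using (⊥; ⊥-elim)
open import Data.Unit using (tt)
open import Data.Vec using (tabulate)
open import Data.Vec.Properties using (lookup∘tabulate; []=⇒lookup; lookup⇒[]=)
open import Data.Vec.Functional using (Vector; _∷_; [])
open import Function using (_∘_)
open import Relation.Nullary using (¬_; Dec; yes; no; does)
open import Relation.Nullary.Decidable
  using (_×-dec_; _⊎-dec_; _→-dec_; ¬?; toWitness; dec-true; decidable-stable)
open import Relation.Unary using (Decidable)
open import Relation.Binary.PropositionalEquality using (_≡_; _≢_; refl; sym; trans; subst; cong)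

private
  variable
    n k d p s t : ℕ

-- Opaque: unfolding the decision procedure at each use would make checking the uses very slow.
opaque
  otherTwoColours : (k l : Fin 4) → k ≢ l →
                    ∃[ o ] ∃[ o′ ] (∀ x → x ≡ k ⊎ x ≡ l ⊎ x ≡ o ⊎ x ≡ o′)
  otherTwoColours = toWitness {a? = search} tt
    where
      search : Dec (∀ (k l : Fin 4) → k ≢ l → ∃[ o ] ∃[ o′ ] (∀ x → x ≡ k ⊎ x ≡ l ⊎ x ≡ o ⊎ x ≡ o′))
      search = Fin.all? λ k → Fin.all? λ l → ¬? (k ≟ l) →-dec Fin.any? λ o → Fin.any? λ o′ →
               Fin.all? λ x → (x ≟ k) ⊎-dec (x ≟ l) ⊎-dec (x ≟ o) ⊎-dec (x ≟ o′)

lastColour : {k l o o′ x : Fin 4} → x ≡ k ⊎ x ≡ l ⊎ x ≡ o ⊎ x ≡ o′ →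
             x ≢ k → x ≢ l → x ≢ o → x ≡ o′
lastColour (inj₁ x≡k)                x≢k _   _   = ⊥-elim (x≢k x≡k)
lastColour (inj₂ (inj₁ x≡l))         _   x≢l _   = ⊥-elim (x≢l x≡l)
lastColour (inj₂ (inj₂ (inj₁ x≡o)))  _   _   x≢o = ⊥-elim (x≢o x≡o)
lastColour (inj₂ (inj₂ (inj₂ x≡o′))) _   _   _   = x≡o′

subset : {P : Fin n → Set} → Decidable P → Subset n
subset P? = tabulate (does ∘ P?)

∈-subset⁺ : {P : Fin n → Set} (P? : Decidable P) {x : Fin n} → P x → x ∈ₛ subset P?
∈-subset⁺ P? {x} px = lookup⇒[]= x (subset P?) (trans (lookup∘tabulate _ x) (dec-true (P? x) px))

∈-subset⁻ : {P : Fin n → Set} (P? : Decidable P) {x : Fin n} → x ∈ₛ subset P? → P x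
∈-subset⁻ P? {x} x∈ with P? x | trans (sym (lookup∘tabulate (does ∘ P?) x)) ([]=⇒lookup x∈)
... | yes px | _  = px
... | no  _  | ()

windowStart : Fin k → ℕ
windowStart b = toℕ b * 6

windowStart<3+k*6 : (b : Fin (suc k)) → 2 + windowStart b < 3 + k * 6
windowStart<3+k*6 b = s≤s (s≤s (s≤s (*-monoˡ-≤ 6 (≤-pred (Fin.toℕ<n b)))))

-- Layer d is at distance ≥ 2 from every layer of the window [p, p + 3].
FarFromWindow : ℕ → ℕ → Set
FarFromWindow d p = 2 + d ≤ p ⊎ 5 + p ≤ d

farFromWindow? : ∀ d p → Dec (FarFromWindow d p)
farFromWindow? d p = (2 + d ≤? p) ⊎-dec (5 + p ≤? d)

nearAtMostOneWindow : {x y : ℕ} → x < y →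
                      ¬ FarFromWindow d (x * 6) → ¬ FarFromWindow d (y * 6) → ⊥
nearAtMostOneWindow {d} {x} {y} x<y nearX nearY = <-irrefl refl (begin-strict
  y * 6      ≤⟨ ≤-pred (≰⇒> (nearY ∘ inj₁)) ⟩
  suc d      <⟨ s≤s (≰⇒> (nearX ∘ inj₂)) ⟩
  suc x * 6  ≤⟨ *-monoˡ-≤ 6 x<y ⟩
  y * 6      ∎)
  where open ≤-Reasoning

freeWindow : (depth : Fin k → ℕ) → ∃[ b ] (∀ i → FarFromWindow (depth i) (windowStart {suc k} b))
freeWindow {k} depth with Fin.any? (λ b → Fin.all? λ i → farFromWindow? (depth i) (windowStart b))
... | yes found = found
... | no none   = ⊥-elim (blockedTwice (Fin.pigeonhole ≤-refl blocker))
  where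
    nearWindow : ∀ b → ∃[ i ] ¬ FarFromWindow (depth i) (windowStart {suc k} b)
    nearWindow b = Fin.¬∀⟶∃¬ k _ (λ i → farFromWindow? (depth i) (windowStart b)) (none ∘ (b ,_))

    blocker : Fin (suc k) → Fin k
    blocker = proj₁ ∘ nearWindow

    blockedTwice : ∃[ b ] ∃[ b′ ] (b <ᶠ b′ × blocker b ≡ blocker b′) → ⊥
    blockedTwice (b , b′ , b<b′ , same) =
      nearAtMostOneWindow b<b′
        (subst (λ i → ¬ FarFromWindow (depth i) (windowStart b)) same (proj₂ (nearWindow b)))
        (proj₂ (nearWindow b′))

walk-snoc : (G : Graph n) {a w x : Fin n} → Walk G a w t → Adj G w x → Walk G a x (suc t)
walk-snoc G here       e′ = step e′ here
walk-snoc G (step e w) e′ = step e (walk-snoc G w e′)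

pair-nonadjacent : (G : Graph n) {x y : Fin n} → ¬ Adj G x y →
                   ∀ s t → ¬ Adj G ((x ∷ y ∷ []) s) ((x ∷ y ∷ []) t)
pair-nonadjacent G x≁y zero       zero       = irrefl G
pair-nonadjacent G x≁y zero       (suc zero) = x≁y
pair-nonadjacent G x≁y (suc zero) zero       = x≁y ∘ Graph.sym G
pair-nonadjacent G x≁y (suc zero) (suc zero) = irrefl G

module Spheres (G : Graph n) (u : Fin n) where

  Ball : ℕ → Fin n → Set
  Ball zero    x = x ≡ u
  Ball (suc t) x = Ball t x ⊎ ∃[ w ] (Ball t w × Adj G w x)

  Sphere : ℕ → Fin n → Set
  Sphere zero    x = x ≡ u
  Sphere (suc t) x = Ball (suc t) x × ¬ Ball t x

  ball? : ∀ t x → Dec (Ball t x)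
  ball? zero    x = x ≟ u
  ball? (suc t) x = ball? t x ⊎-dec Fin.any? λ w → ball? t w ×-dec dec G w x

  centre∈ball : ∀ t → Ball t u
  centre∈ball zero    = refl
  centre∈ball (suc t) = inj₁ (centre∈ball t)

  ball-mono′ : {x : Fin n} → t ≤′ s → Ball t x → Ball s x
  ball-mono′ ≤′-refl        x∈ = x∈
  ball-mono′ (≤′-step t≤s) x∈ = inj₁ (ball-mono′ t≤s x∈)

  ball-mono : {x : Fin n} → t ≤ s → Ball t x → Ball s x
  ball-mono = ball-mono′ ∘ ≤⇒≤′

  sphere⇒ball : {x : Fin n} → Sphere t x → Ball t x
  sphere⇒ball {zero}  x∈ = x∈
  sphere⇒ball {suc t} x∈ = proj₁ x∈

  ball⇒walk : {x : Fin n} → Ball t x → ∃[ m ] (m ≤ t × Walk G u x m)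
  ball⇒walk {zero}  refl = 0 , z≤n , here
  ball⇒walk {suc t} (inj₁ x∈) with ball⇒walk x∈
  ... | m , m≤t , w = m , m≤n⇒m≤1+n m≤t , w
  ball⇒walk {suc t} (inj₂ (_ , w∈ , e)) with ball⇒walk w∈
  ... | m , m≤t , w = suc m , s≤s m≤t , walk-snoc G w e

  walk⇒ball : {a b : Fin n} → Walk G a b s → Ball t a → Ball (s + t) b
  walk⇒ball here                a∈ = a∈
  walk⇒ball {a = a} {b} (step e w) a∈ =
    subst (λ r → Ball r b) (+-suc _ _) (walk⇒ball w (inj₂ (a , a∈ , e)))

  ball⇒sphere : {x : Fin n} → Ball t x → ∃[ d ] Sphere d x
  ball⇒sphere {zero}      x∈ = 0 , x∈
  ball⇒sphere {suc t} {x} x∈ with ball? t x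
  ... | yes x∈′ = ball⇒sphere x∈′
  ... | no  x∉  = suc t , x∈ , x∉

  leaveBall : {a b : Fin n} → Walk G a b d → Ball t a → ¬ Ball t b → ∃[ x ] Sphere (suc t) x
  leaveBall here         a∈ b∉ = ⊥-elim (b∉ a∈)
  leaveBall {t = t} {a} (step {w = w} e walk) a∈ b∉ with ball? t w
  ... | yes w∈ = leaveBall walk w∈ b∉
  ... | no  w∉ = w , inj₂ (a , a∈ , e) , w∉

  sphere-parent : {x : Fin n} → Sphere (suc t) x → ∃[ w ] (Sphere t w × Adj G w x)
  sphere-parent         (inj₁ x∈ , x∉)           = ⊥-elim (x∉ x∈)
  sphere-parent {zero}  (inj₂ (w , w∈ , e) , _)  = w , w∈ , e
  sphere-parent {suc t} (inj₂ (w , w∈ , e) , x∉) = w , (w∈ , λ w∈′ → x∉ (inj₂ (w , w∈′ , e))) , e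

  sphere-nonadjacent : {a x : Fin n} → Sphere s a → Sphere d x → 2 + s ≤ d → ¬ Adj G a x
  sphere-nonadjacent {s} {suc d} {a} a∈ (_ , x∉) s+2≤d e =
    x∉ (ball-mono (≤-pred s+2≤d) (inj₂ (a , sphere⇒ball a∈ , e)))

  sphere-of : Connected G → ∀ x → ∃[ d ] Sphere d x
  sphere-of conn x = ball⇒sphere (walk⇒ball (proj₂ (conn u x)) refl)

  sphere-inhabited : Connected G → {v : Fin n} → DistAtLeast G u v d → t < d → ∃[ x ] Sphere (suc t) x
  sphere-inhabited {t = t} conn {v} far t<d = leaveBall (proj₂ (conn u v)) (centre∈ball t) v∉
    where
      v∉ : ¬ Ball t v
      v∉ v∈ with ball⇒walk v∈
      ... | m , m≤t , walk = far m (≤-trans (s≤s m≤t) t<d) walk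

  InWindow : ℕ → Fin n → Set
  InWindow p x = ∃[ e ] (Sphere e x × p ≤ e × e ≤ 3 + p)

  farFromWindow-nonadjacent : {x y : Fin n} → Sphere d y → FarFromWindow d p → InWindow p x →
                              ¬ Adj G x y
  farFromWindow-nonadjacent y∈ (inj₁ d+2≤p) (e , x∈ , p≤e , _) =
    sphere-nonadjacent y∈ x∈ (≤-trans d+2≤p p≤e) ∘ Graph.sym G
  farFromWindow-nonadjacent y∈ (inj₂ p+5≤d) (e , x∈ , _ , e≤p+3) =
    sphere-nonadjacent x∈ y∈ (≤-trans (s≤s (s≤s e≤p+3)) p+5≤d)

  inWindow : ∀ j {x : Fin n} → j ≤ 3 → Sphere (j + p) x → InWindow p x
  inWindow {p} j j≤3 x∈ = j + p , x∈ , m≤n+m p j , +-monoˡ-≤ p j≤3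

  -- Of z₀ ∈ S_p and an edge z₂z₃ from S_{p+2} to S_{p+3}, z₀ differs in colour from z₂ or z₃.
  windowPair : (c : ProperColoring G k) {z₃ : Fin n} → Sphere (3 + p) z₃ →
               ∃[ a ] ∃[ b ] (InWindow p a × InWindow p b × col c a ≢ col c b × ¬ Adj G a b)
  windowPair {p = p} c {z₃} z₃∈ with sphere-parent z₃∈
  ... | z₂ , z₂∈ , z₂~z₃ with sphere-parent z₂∈
  ... | _  , z₁∈ , _     with sphere-parent z₁∈
  ... | z₀ , z₀∈ , _     with col c z₀ ≟ col c z₂
  ... | no  c₀≢c₂ = z₀ , z₂ , inWindow 0 z≤n z₀∈ , inWindow 2 (n≤1+n 2) z₂∈ , c₀≢c₂ ,
                    sphere-nonadjacent z₀∈ z₂∈ ≤-refl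
  ... | yes c₀≡c₂ = z₀ , z₃ , inWindow 0 z≤n z₀∈ , inWindow 3 ≤-refl z₃∈ ,
                    (λ c₀≡c₃ → proper c z₂~z₃ (trans (sym c₀≡c₂) c₀≡c₃)) ,
                    sphere-nonadjacent z₀∈ z₃∈ (n≤1+n (2 + p))

Conclusion : Graph n → Set
Conclusion {n} G =
  Σ (Subset n) λ A → Σ (Subset n) λ B → CompleteBipartiteSubgraph G A B × BipartiteAfterDeleting G A B

module Colouring {G : Graph n} (c : ProperColoring G 4) where

  Complete : Fin 4 → Fin 4 → Set
  Complete i j = ∀ a b → col c a ≡ i → col c b ≡ j → Adj G a b

  complete? : ∀ i j → Dec (Complete i j)
  complete? i j = Fin.all? λ a → Fin.all? λ b → (col c a ≟ i) →-dec (col c b ≟ j) →-dec dec G a b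

  ¬complete-self : ∀ i → ¬ Complete i i
  ¬complete-self i complete with nonempty c i
  ... | x , x∈i = irrefl G (complete x x x∈i x∈i)

  nonadjacentPair : {i j : Fin 4} → ¬ Complete i j →
                    ∃[ a ] ∃[ b ] (col c a ≡ i × col c b ≡ j × ¬ Adj G a b)
  nonadjacentPair {i} {j} incomplete
    with Fin.any? (λ a → Fin.any? λ b → (col c a ≟ i) ×-dec (col c b ≟ j) ×-dec ¬? (dec G a b))
  ... | yes found = found
  ... | no  none  = ⊥-elim (incomplete λ a b a∈i b∈j →
                      decidable-stable (dec G a b) λ a≁b → none (a , b , a∈i , b∈j , a≁b))

  colourClass : Fin 4 → Subset n
  colourClass i = subset (λ x → col c x ≟ i)

  ∈colourClass⁺ : {i : Fin 4} {x : Fin n} → col c x ≡ i → x ∈ₛ colourClass i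
  ∈colourClass⁺ {i} = ∈-subset⁺ (λ x → col c x ≟ i)

  ∈colourClass⁻ : {i : Fin 4} {x : Fin n} → x ∈ₛ colourClass i → col c x ≡ i
  ∈colourClass⁻ {i} = ∈-subset⁻ (λ x → col c x ≟ i)

  complete⇒conclusion : {i j : Fin 4} → i ≢ j → Complete i j → Conclusion G
  complete⇒conclusion {i} {j} i≢j complete =
    colourClass i , colourClass j ,
    (inhabited i , inhabited j , disjoint ,
     λ a b a∈i b∈j → complete a b (∈colourClass⁻ a∈i) (∈colourClass⁻ b∈j)) ,
    twoColouring , twoColouring-proper
    where
      inhabited : ∀ i → ∃[ x ] x ∈ₛ colourClass i
      inhabited i with nonempty c i
      ... | x , x∈i = x , ∈colourClass⁺ x∈i

      disjoint : ∀ x → x ∈ₛ colourClass i → x ∉ colourClass j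
      disjoint x x∈i x∈j = i≢j (trans (sym (∈colourClass⁻ x∈i)) (∈colourClass⁻ x∈j))

      o  = proj₁ (otherTwoColours i j i≢j)
      o′ = proj₁ (proj₂ (otherTwoColours i j i≢j))

      colour≡o′ : ∀ x → x ∉ colourClass i → x ∉ colourClass j → col c x ≢ o → col c x ≡ o′
      colour≡o′ x x∉i x∉j = lastColour (proj₂ (proj₂ (otherTwoColours i j i≢j)) (col c x))
                              (x∉i ∘ ∈colourClass⁺) (x∉j ∘ ∈colourClass⁺)

      twoColouring : Fin n → Fin 2
      twoColouring x with col c x ≟ o
      ... | yes _ = zero
      ... | no  _ = suc zero

      twoColouring-proper : ∀ x y → x ∉ colourClass i → x ∉ colourClass j → y ∉ colourClass i →
                            y ∉ colourClass j → Adj G x y → twoColouring x ≢ twoColouring y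
      twoColouring-proper x y x∉i x∉j y∉i y∉j x~y with col c x ≟ o | col c y ≟ o
      ... | yes x≡o | yes y≡o = λ _ → proper c x~y (trans x≡o (sym y≡o))
      ... | yes _   | no  _   = λ ()
      ... | no  _   | yes _   = λ ()
      ... | no  x≢o | no  y≢o = λ _ → proper c x~y
                                  (trans (colour≡o′ x x∉i x∉j x≢o) (sym (colour≡o′ y y∉i y∉j y≢o)))

  module NoCompletePair (conn : Connected G) (ec : EdgeCompelling G c) {u v : Fin n}
                        (incomplete : ∀ i j → ¬ Complete i j) where
    open Spheres G u

    depth : Fin n → ℕ
    depth x = proj₁ (sphere-of conn x)

    witness : Fin 4 → Fin 4 → Vector (Fin n) 2
    witness i j = let a , b , _ = nonadjacentPair (incomplete i j) in a ∷ b ∷ []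

    witness-colour : ∀ i j s → col c (witness i j s) ≡ (i ∷ j ∷ []) s
    witness-colour i j zero       = proj₁ (proj₂ (proj₂ (nonadjacentPair (incomplete i j))))
    witness-colour i j (suc zero) = proj₁ (proj₂ (proj₂ (proj₂ (nonadjacentPair (incomplete i j)))))

    witness-nonadjacent : ∀ i j → ¬ Adj G (witness i j zero) (witness i j (suc zero))
    witness-nonadjacent i j = proj₂ (proj₂ (proj₂ (proj₂ (nonadjacentPair (incomplete i j)))))

    allWitnesses : Fin (4 * 4 * 2) → Fin n
    allWitnesses = uncurry (uncurry witness ∘ remQuot 4) ∘ remQuot 2

    allWitnesses-combine : ∀ i j s → allWitnesses (combine (combine i j) s) ≡ witness i j s
    allWitnesses-combine i j s =
      trans (cong (uncurry (uncurry witness ∘ remQuot 4)) (Fin.remQuot-combine (combine i j) s))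
            (cong (λ ij → uncurry witness ij s) (Fin.remQuot-combine i j))

    windowPair⇒⊥ : ∀ {p a a′} → InWindow p a → InWindow p a′ → col c a ≢ col c a′ → ¬ Adj G a a′ →
                   (∀ i j s → FarFromWindow (depth (witness i j s)) p) → ⊥
    windowPair⇒⊥ {p} {a} {a′} a∈ a′∈ colours≢ a≁a′ far =
      let i , j , adj = ec committee in independent (slotOf i) (slotOf j) adj
      where
        others = otherTwoColours (col c a) (col c a′) colours≢
        o      = proj₁ others
        o′     = proj₁ (proj₂ others)

        member : Fin 2 ⊎ Fin 2 → Fin n
        member = [ a ∷ a′ ∷ [] , witness o o′ ]′

        slot : ∀ {x} → x ≡ col c a ⊎ x ≡ col c a′ ⊎ x ≡ o ⊎ x ≡ o′ → ∃[ s ] col c (member s) ≡ x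
        slot (inj₁ refl)               = inj₁ zero , refl
        slot (inj₂ (inj₁ refl))        = inj₁ (suc zero) , refl
        slot (inj₂ (inj₂ (inj₁ refl))) = inj₂ zero , witness-colour o o′ zero
        slot (inj₂ (inj₂ (inj₂ refl))) = inj₂ (suc zero) , witness-colour o o′ (suc zero)

        slotOf : Fin 4 → Fin 2 ⊎ Fin 2
        slotOf x = proj₁ (slot (proj₂ (proj₂ others) x))

        committee : RainbowCommittee G c
        committee = member ∘ slotOf , λ x → proj₂ (slot (proj₂ (proj₂ others) x))

        pair∈window : ∀ s → InWindow p ((a ∷ a′ ∷ []) s)
        pair∈window zero       = a∈
        pair∈window (suc zero) = a′∈

        pair≁witness : ∀ s t → ¬ Adj G ((a ∷ a′ ∷ []) s) (witness o o′ t)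
        pair≁witness s t = farFromWindow-nonadjacent (proj₂ (sphere-of conn _)) (far o o′ t) (pair∈window s)

        independent : ∀ s t → ¬ Adj G (member s) (member t)
        independent (inj₁ s) (inj₁ t) = pair-nonadjacent G a≁a′ s t
        independent (inj₁ s) (inj₂ t) = pair≁witness s t
        independent (inj₂ s) (inj₁ t) = pair≁witness t s ∘ Graph.sym G
        independent (inj₂ s) (inj₂ t) = pair-nonadjacent G (witness-nonadjacent o o′) s t

    contradiction : DistAtLeast G u v (3 + 32 * 6) → ⊥
    contradiction far =
      let _ , _ , a∈ , a′∈ , colours≢ , a≁a′ = windowPair c (proj₂ top) in
      windowPair⇒⊥ a∈ a′∈ colours≢ a≁a′ witness-far
      where
        window : ∃[ b ] (∀ i → FarFromWindow (depth (allWitnesses i)) (windowStart b))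
        window = freeWindow (depth ∘ allWitnesses)

        start : ℕ
        start = windowStart (proj₁ window)

        top : ∃[ z ] Sphere (3 + start) z
        top = sphere-inhabited conn far (windowStart<3+k*6 (proj₁ window))

        witness-far : ∀ i j s → FarFromWindow (depth (witness i j s)) start
        witness-far i j s = subst (λ w → FarFromWindow (depth w) start)
                              (allWitnesses-combine i j s) (proj₂ window (combine (combine i j) s))

  conclusion : Connected G → EdgeCompelling G c → {u v : Fin n} → DistAtLeast G u v (3 + 32 * 6) →
               Conclusion G
  conclusion conn ec {u} {v} far with Fin.any? (λ i → Fin.any? λ j → ¬? (i ≟ j) ×-dec complete? i j)
  ... | yes (i , j , i≢j , complete) = complete⇒conclusion i≢j complete
  ... | no  none = ⊥-elim (NoCompletePair.contradiction conn ec {u} {v} incomplete far)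
    where
      incomplete : ∀ i j → ¬ Complete i j
      incomplete i j with i ≟ j
      ... | yes refl = ¬complete-self i
      ... | no  i≢j  = λ complete → none (i , j , i≢j , complete)

mainTheorem10 : ∃[ D ] (0 < D) × (∀ (n : ℕ) (G : Graph n) → Connected G → ECChromaticNumberIs G 4 → DiameterAtLeast G D → Σ (Subset n) λ A → Σ (Subset n) λ B → CompleteBipartiteSubgraph G A B × BipartiteAfterDeleting G A B)
mainTheorem10 = 3 + 32 * 6 , s≤s z≤n , λ n G conn ((c , ec) , _) (u , v , far) →
  Colouring.conclusion c conn ec far
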